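{- For every modified ascent sequence $x$, the permutation $\mathfrak{st}(x)$ belongs to $\Omega$.
   Context: A Cayley permutation of length $n$ is a word $x=x_1\cdots x_n$ of positive integers whose set of values is $\{1,\dots,k\}$ for some $k\le n$. The ascent tops of $x$ are the pairs $(1,x_1)$ and $(i,x_i)$ with $1<i\le n$ and $x_{i-1}<x_i$; the leftmost copies of $x$ are the pairs $(\min\{i:x_i=j\},j)$ for $1\le j\le\max(x)$. A modified ascent sequence is a Cayley permutation whose set of ascent tops equals its set of leftmost copies. Standardization: if $a_i$ is the number of entries of $x$ equal to $i$, then $\mathfrak{st}(x)$ is the permutation obtained by replacing the $a_i$ copies of $i$, from left to right, by $a_1+\cdots+a_{i-1}+1,\dots,a_1+\cdots+a_{i-1}+a_i$. $\Omega$ is the set of permutations $p=p_1\cdots p_n$ (of any length $n\ge0$) such that either $n=0$ or $p_1=1$, and such that there are no indices $i,j$ with $i+1<j$, $p_i>p_{i+1}$ and $p_{i+1}=p_j+1$. -}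

module Defs where

open import Data.Nat using (ℕ; zero; suc; _+_; _≤_; _<_; _⊔_; _≡ᵇ_; _<ᵇ_; _≤ᵇ_; pred)
open import Data.Fin using (Fin; toℕ) renaming (zero to fzero; suc to fsuc)
open import Data.Bool using (Bool; true; false; if_then_else_; _∧_)
open import Data.Product using (Σ; _×_; ∃; _,_)
open import Data.Sum using (_⊎_)
open import Data.Empty using (⊥)
open import Function using (_∘_; _⇔_)
open import Function.Definitions using (Injective)
open import Relation.Binary.PropositionalEquality using (_≡_)

Word : ℕ → Set
Word n = Fin n → ℕ

cnt : ∀ {n} → (Fin n → Bool) → ℕ
cnt {zero}  f = 0
cnt {suc n} f = (if f fzero then 1 else 0) + cnt (f ∘ fsuc)

maxW : ∀ {n} → Word n → ℕ
maxW {zero}  x = 0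
maxW {suc n} x = x fzero ⊔ maxW (x ∘ fsuc)

IsCayley : ∀ {n} → Word n → Set
IsCayley {n} x = Σ ℕ λ k → k ≤ n ×
  (∀ v → (Σ (Fin n) λ i → x i ≡ v) ⇔ (1 ≤ v × v ≤ k))

AscentTop : ∀ {n} → Word n → Fin n → ℕ → Set
AscentTop {n} x i v = x i ≡ v ×
  (toℕ i ≡ 0 ⊎ Σ (Fin n) λ k → toℕ i ≡ suc (toℕ k) × x k < x i)

LeftmostCopy : ∀ {n} → Word n → Fin n → ℕ → Set
LeftmostCopy {n} x i v = 1 ≤ v × v ≤ maxW x × x i ≡ v ×
  (∀ (j : Fin n) → x j ≡ v → toℕ i ≤ toℕ j)

IsModAsc : ∀ {n} → Word n → Set
IsModAsc x = IsCayley x × (∀ i v → AscentTop x i v ⇔ LeftmostCopy x i v)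

occ : ∀ {n} → Word n → ℕ → ℕ
occ x u = cnt (λ j → x j ≡ᵇ u)

occSum : ∀ {n} → Word n → ℕ → ℕ
occSum x zero    = 0
occSum x (suc m) = occSum x m + occ x (suc m)

-- standardization: the k-th copy (from the left) of value v becomes
-- a_1 + … + a_{v-1} + k
st : ∀ {n} → Word n → Word n
st x i = occSum x (pred (x i))
       + cnt (λ j → (toℕ j ≤ᵇ toℕ i) ∧ (x j ≡ᵇ x i))

IsPerm : ∀ {n} → Word n → Set
IsPerm {n} p = Injective _≡_ _≡_ p × (∀ i → 1 ≤ p i × p i ≤ n)

InΩ : ∀ {n} → Word n → Set
InΩ {n} p = IsPerm p
  × (∀ (i : Fin n) → toℕ i ≡ 0 → p i ≡ 1)
  × (∀ (i k j : Fin n) → toℕ k ≡ suc (toℕ i) → toℕ k < toℕ j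
       → p k < p i → p k ≡ p j + 1 → ⊥)

module Submission where

-- For positive entries, st x i counts the positions j with (x j, j) ≤ (x i, i)
-- lexicographically, i.e. it is the rank of i in the order ≺ on (value, position);
-- hence st x is a permutation and st x i < st x j exactly when i ≺ j.
-- In a modified ascent sequence every leftmost copy is an ascent top.  Walking back
-- from any entry, to an earlier copy of its value or, at a leftmost copy, to the
-- smaller entry just before it, ends at the first entry, which is therefore a
-- minimum value and standardizes to 1.  In a forbidden pattern p_i > p_{i+1} = p_j + 1
-- with j > i + 1, the position j is the immediate ≺-predecessor of i + 1 and lies to
-- its right, so x_j < x_{i+1}; an earlier copy of x_{i+1} would lie strictly between
-- them, so i + 1 is a leftmost copy, hence an ascent top, and x_i < x_{i+1} forces
-- p_i < p_{i+1}.

open import Data.Bool using (Bool; true; false; T; _∧_; _∨_; if_then_else_)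
open import Data.Bool.Properties using (T-∧; T-∨)
open import Data.Empty using (⊥; ⊥-elim)
open import Data.Fin using (Fin; toℕ) renaming (zero to fzero; suc to fsuc; _<_ to _<ᶠ_)
open import Data.Fin.Induction using (<-wellFounded)
open import Data.Fin.Properties using (toℕ-injective; any?) renaming (suc-injective to fsuc-injective; 0≢1+n to fzero≢fsuc)
open import Data.Nat using (ℕ; zero; suc; _+_; _≤_; _<_; _≤ᵇ_; _<ᵇ_; _≡ᵇ_; pred; z≤n; z<s; >-nonZero)
open import Data.Nat.Properties
open import Algebra.Properties.CommutativeSemigroup +-commutativeSemigroup using (interchange)
open import Data.Product using (_×_; _,_; proj₁; proj₂; ∃-syntax)
open import Data.Product.Relation.Binary.Lex.Strict using (×-Lex; ×-transitive; ×-asymmetric; ×-compare)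
open import Data.Sum using (_⊎_; inj₁; inj₂; [_,_])
open import Data.Unit using (tt)
open import Function using (_∘_; _⇔_; Equivalence)
open import Induction.WellFounded using (Acc; acc)
open import Relation.Binary.Definitions using (tri<; tri≈; tri>)
open import Relation.Binary.PropositionalEquality
  using (_≡_; _≢_; refl; sym; trans; cong; subst; subst₂; cong₂; isEquivalence; resp₂; module ≡-Reasoning)
open import Relation.Nullary using (¬_; yes; no)
open import Relation.Nullary.Decidable using (_×-dec_)
open import Defs

bit : Bool → ℕ
bit b = if b then 1 else 0

bit-∨ : ∀ p q → (T p → T q → ⊥) → bit (p ∨ q) ≡ bit p + bit q
bit-∨ false q     _        = refl
bit-∨ true  false _        = refl
bit-∨ true  true  disjoint = ⊥-elim (disjoint tt tt)

bit-<ᵇ-suc : ∀ a m → bit (a <ᵇ suc m) ≡ bit (a <ᵇ m) + bit (a ≡ᵇ m)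
bit-<ᵇ-suc zero    zero    = refl
bit-<ᵇ-suc zero    (suc m) = refl
bit-<ᵇ-suc (suc a) zero    = refl
bit-<ᵇ-suc (suc a) (suc m) = bit-<ᵇ-suc a m

bit-mono : ∀ p q → (T p → T q) → bit p ≤ bit q
bit-mono false q     _ = z≤n
bit-mono true  true  _ = ≤-refl
bit-mono true  false p⇒q = ⊥-elim (p⇒q tt)

cnt-+ : ∀ {n} (f g h : Fin n → Bool) →
        (∀ j → bit (h j) ≡ bit (f j) + bit (g j)) → cnt h ≡ cnt f + cnt g
cnt-+ {zero}  f g h pointwise = refl
cnt-+ {suc n} f g h pointwise = begin
  bit (h fzero) + cnt (h ∘ fsuc)
    ≡⟨ cong₂ _+_ (pointwise fzero) (cnt-+ (f ∘ fsuc) (g ∘ fsuc) (h ∘ fsuc) (pointwise ∘ fsuc)) ⟩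
  (bit (f fzero) + bit (g fzero)) + (cnt (f ∘ fsuc) + cnt (g ∘ fsuc))
    ≡⟨ interchange (bit (f fzero)) (bit (g fzero)) (cnt (f ∘ fsuc)) (cnt (g ∘ fsuc)) ⟩
  (bit (f fzero) + cnt (f ∘ fsuc)) + (bit (g fzero) + cnt (g ∘ fsuc)) ∎
  where open ≡-Reasoning

cnt-none : ∀ {n} (f : Fin n → Bool) → (∀ j → ¬ T (f j)) → cnt f ≡ 0
cnt-none {zero}  f never = refl
cnt-none {suc n} f never with f fzero in eq
... | true  = ⊥-elim (never fzero (subst T (sym eq) tt))
... | false = cnt-none (f ∘ fsuc) (never ∘ fsuc)

cnt-unique : ∀ {n} (f : Fin n → Bool) (i : Fin n) →
             T (f i) → (∀ j → T (f j) → j ≡ i) → cnt f ≡ 1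
cnt-unique f fzero fi only with f fzero
... | true = cong suc (cnt-none (f ∘ fsuc) (λ j fj → fzero≢fsuc (sym (only (fsuc j) fj))))
cnt-unique f (fsuc i) fi only with f fzero in eq
... | true  = ⊥-elim (fzero≢fsuc (only fzero (subst T (sym eq) tt)))
... | false = cnt-unique (f ∘ fsuc) i fi (λ j fj → fsuc-injective (only (fsuc j) fj))

cnt-mono : ∀ {n} (f g : Fin n → Bool) → (∀ j → T (f j) → T (g j)) → cnt f ≤ cnt g
cnt-mono {zero}  f g f⊆g = z≤n
cnt-mono {suc n} f g f⊆g =
  +-mono-≤ (bit-mono (f fzero) (g fzero) (f⊆g fzero)) (cnt-mono (f ∘ fsuc) (g ∘ fsuc) (f⊆g ∘ fsuc))

cnt-mono-< : ∀ {n} (f g : Fin n → Bool) → (∀ j → T (f j) → T (g j)) →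
             (i : Fin n) → T (g i) → ¬ T (f i) → cnt f < cnt g
cnt-mono-< f g f⊆g fzero gi ¬fi =
  +-mono-<-≤ (bit< (f fzero) (g fzero) gi ¬fi) (cnt-mono (f ∘ fsuc) (g ∘ fsuc) (f⊆g ∘ fsuc))
  where
  bit< : ∀ p q → T q → ¬ T p → bit p < bit q
  bit< false true _ _  = z<s
  bit< true  q    _ ¬p = ⊥-elim (¬p tt)
cnt-mono-< f g f⊆g (fsuc i) gi ¬fi =
  +-mono-≤-< (bit-mono (f fzero) (g fzero) (f⊆g fzero)) (cnt-mono-< (f ∘ fsuc) (g ∘ fsuc) (f⊆g ∘ fsuc) i gi ¬fi)

cnt-pos : ∀ {n} (f : Fin n → Bool) (i : Fin n) → T (f i) → 1 ≤ cnt f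
cnt-pos f fzero    fi with f fzero
... | true = z<s
cnt-pos f (fsuc i) fi = ≤-trans (cnt-pos (f ∘ fsuc) i fi) (m≤n+m _ _)

cnt≤length : ∀ {n} (f : Fin n → Bool) → cnt f ≤ n
cnt≤length {zero}  f = z≤n
cnt≤length {suc n} f = +-mono-≤ (bit≤1 (f fzero)) (cnt≤length (f ∘ fsuc))
  where
  bit≤1 : ∀ p → bit p ≤ 1
  bit≤1 false = z≤n
  bit≤1 true  = ≤-refl

≤-maxW : ∀ {n} (x : Word n) i → x i ≤ maxW x
≤-maxW x fzero    = m≤m⊔n (x fzero) _
≤-maxW x (fsuc i) = ≤-trans (≤-maxW (x ∘ fsuc) i) (m≤n⊔m (x fzero) _)

IsCayley⇒positive : ∀ {n} {x : Word n} → IsCayley x → ∀ j → 1 ≤ x j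
IsCayley⇒positive (_ , _ , values) j = proj₁ (Equivalence.to (values _) (j , refl))

module Standardization {n : ℕ} (x : Word n) (positive : ∀ j → 1 ≤ x j) where

  _≺_ : Fin n → Fin n → Set
  i ≺ j = ×-Lex _≡_ _<_ _<_ (x i , toℕ i) (x j , toℕ j)

  _≼_ : Fin n → Fin n → Set
  i ≼ j = i ≺ j ⊎ i ≡ j

  ≺-trans : ∀ {i j k} → i ≺ j → j ≺ k → i ≺ k
  ≺-trans = ×-transitive {_≈₁_ = _≡_} {_<₁_ = _<_} {_<₂_ = _<_} isEquivalence (resp₂ _<_) <-trans <-trans

  ≺-asym : ∀ {i j} → i ≺ j → ¬ j ≺ i
  ≺-asym = ×-asymmetric {_≈₁_ = _≡_} {_<₁_ = _<_} {_<₂_ = _<_} sym (resp₂ _<_) <-asym <-asym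

  ≺⇒⋡ : ∀ {i j} → i ≺ j → ¬ j ≼ i
  ≺⇒⋡ i≺j (inj₁ j≺i) = ≺-asym i≺j j≺i
  ≺⇒⋡ i≺j (inj₂ refl) = ≺-asym i≺j i≺j

  ≼-≺-trans : ∀ {i j k} → i ≼ j → j ≺ k → i ≺ k
  ≼-≺-trans (inj₁ i≺j) j≺k = ≺-trans i≺j j≺k
  ≼-≺-trans (inj₂ refl) j≺k = j≺k

  ≺-trichotomy : ∀ i j → i ≺ j ⊎ i ≡ j ⊎ j ≺ i
  ≺-trichotomy i j with ×-compare sym <-cmp <-cmp (x i , toℕ i) (x j , toℕ j)
  ... | tri< i≺j _ _        = inj₁ i≺j
  ... | tri≈ _ (_ , i≡j) _  = inj₂ (inj₁ (toℕ-injective i≡j))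
  ... | tri> _ _ j≺i        = inj₂ (inj₂ j≺i)

  _≼ᵇ_ : Fin n → Fin n → Bool
  j ≼ᵇ i = (x j <ᵇ x i) ∨ ((toℕ j ≤ᵇ toℕ i) ∧ (x j ≡ᵇ x i))

  ≼ᵇ⇒≼ : ∀ {j i} → T (j ≼ᵇ i) → j ≼ i
  ≼ᵇ⇒≼ {j} {i} t with Equivalence.to T-∨ t
  ... | inj₁ x<x = inj₁ (inj₁ (<ᵇ⇒< (x j) (x i) x<x))
  ... | inj₂ t′ with Equivalence.to T-∧ t′
  ... | pos≤pos , x≡x with m≤n⇒m<n∨m≡n (≤ᵇ⇒≤ (toℕ j) (toℕ i) pos≤pos)
  ... | inj₁ pos<pos = inj₁ (inj₂ (≡ᵇ⇒≡ (x j) (x i) x≡x , pos<pos))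
  ... | inj₂ pos≡pos = inj₂ (toℕ-injective pos≡pos)

  ≼⇒≼ᵇ : ∀ {j i} → j ≼ i → T (j ≼ᵇ i)
  ≼⇒≼ᵇ (inj₁ (inj₁ x<x)) = Equivalence.from T-∨ (inj₁ (<⇒<ᵇ x<x))
  ≼⇒≼ᵇ {j} {i} (inj₁ (inj₂ (x≡x , pos<pos))) =
    Equivalence.from T-∨ (inj₂ (Equivalence.from T-∧ (≤⇒≤ᵇ (<⇒≤ pos<pos) , ≡⇒≡ᵇ (x j) (x i) x≡x)))
  ≼⇒≼ᵇ {j} (inj₂ refl) =
    Equivalence.from (T-∨ {x = x j <ᵇ x j})
      (inj₂ (Equivalence.from T-∧ (≤⇒≤ᵇ (≤-refl {toℕ j}) , ≡⇒≡ᵇ (x j) (x j) refl)))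

  rank : Fin n → ℕ
  rank i = cnt (_≼ᵇ i)

  occSum≡cnt< : ∀ m → occSum x m ≡ cnt (λ j → x j <ᵇ suc m)
  occSum≡cnt< zero    = sym (cnt-none _ (λ j → ¬<1 (x j) (positive j)))
    where
    ¬<1 : ∀ a → 1 ≤ a → ¬ T (a <ᵇ 1)
    ¬<1 (suc a) _ ()
  occSum≡cnt< (suc m) = begin
    occSum x m + occ x (suc m)
      ≡⟨ cong (_+ occ x (suc m)) (occSum≡cnt< m) ⟩
    cnt (λ j → x j <ᵇ suc m) + occ x (suc m)
      ≡⟨ cnt-+ _ _ _ (λ j → bit-<ᵇ-suc (x j) (suc m)) ⟨
    cnt (λ j → x j <ᵇ suc (suc m)) ∎
    where open ≡-Reasoning

  st≡rank : ∀ i → st x i ≡ rank i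
  st≡rank i = begin
    occSum x (pred (x i)) + cnt equalBefore
      ≡⟨ cong (_+ cnt equalBefore) (occSum≡cnt< (pred (x i))) ⟩
    cnt (λ j → x j <ᵇ suc (pred (x i))) + cnt equalBefore
      ≡⟨ cong (λ b → cnt (λ j → x j <ᵇ b) + cnt equalBefore) suc-pred-xi ⟩
    cnt (λ j → x j <ᵇ x i) + cnt equalBefore
      ≡⟨ cnt-+ _ _ _ (λ j → bit-∨ _ _ (<ᵇ-disjoint j)) ⟨
    rank i ∎
    where
    open ≡-Reasoning
    suc-pred-xi : suc (pred (x i)) ≡ x i
    suc-pred-xi = suc-pred (x i) {{>-nonZero (positive i)}}
    equalBefore : Fin n → Bool
    equalBefore j = (toℕ j ≤ᵇ toℕ i) ∧ (x j ≡ᵇ x i)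
    <ᵇ-disjoint : ∀ j → T (x j <ᵇ x i) → T (equalBefore j) → ⊥
    <ᵇ-disjoint j x<x t = <-irrefl (≡ᵇ⇒≡ (x j) (x i) (proj₂ (Equivalence.to T-∧ t))) (<ᵇ⇒< (x j) (x i) x<x)

  st-mono : ∀ {i j} → i ≺ j → st x i < st x j
  st-mono {i} {j} i≺j = subst₂ _<_ (sym (st≡rank i)) (sym (st≡rank j))
    (cnt-mono-< (_≼ᵇ i) (_≼ᵇ j) (λ k k≼i → ≼⇒≼ᵇ (inj₁ (≼-≺-trans (≼ᵇ⇒≼ k≼i) i≺j)))
                j (≼⇒≼ᵇ (inj₂ refl)) (≺⇒⋡ i≺j ∘ ≼ᵇ⇒≼))

  st-reflects-< : ∀ {i j} → st x i < st x j → i ≺ j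
  st-reflects-< {i} {j} st<st with ≺-trichotomy i j
  ... | inj₁ i≺j        = i≺j
  ... | inj₂ (inj₁ refl) = ⊥-elim (<-irrefl refl st<st)
  ... | inj₂ (inj₂ j≺i) = ⊥-elim (<-asym st<st (st-mono j≺i))

  st-injective : ∀ i j → st x i ≡ st x j → i ≡ j
  st-injective i j st≡st with ≺-trichotomy i j
  ... | inj₁ i≺j         = ⊥-elim (<-irrefl st≡st (st-mono i≺j))
  ... | inj₂ (inj₁ i≡j)  = i≡j
  ... | inj₂ (inj₂ j≺i)  = ⊥-elim (<-irrefl (sym st≡st) (st-mono j≺i))

  st-isPerm : IsPerm (st x)
  st-isPerm = (λ {i} {j} → st-injective i j) , λ i →
      subst (1 ≤_) (sym (st≡rank i)) (cnt-pos _ i (≼⇒≼ᵇ (inj₂ refl)))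
    , subst (_≤ n) (sym (st≡rank i)) (cnt≤length _)

  st-minimum : ∀ i → (∀ j → ¬ j ≺ i) → st x i ≡ 1
  st-minimum i minimal = trans (st≡rank i) (cnt-unique _ i (≼⇒≼ᵇ (inj₂ refl)) only-i)
    where
    only-i : ∀ j → T (j ≼ᵇ i) → j ≡ i
    only-i j j≼i with ≼ᵇ⇒≼ j≼i
    ... | inj₁ j≺i = ⊥-elim (minimal j j≺i)
    ... | inj₂ j≡i = j≡i

  st-consecutive : ∀ {i j} → st x j ≡ suc (st x i) → ∀ k → i ≺ k → ¬ k ≺ j
  st-consecutive j≡1+i k i≺k k≺j =
    <⇒≱ (st-mono i≺k) (≤-pred (subst (st x k <_) j≡1+i (st-mono k≺j)))

module ModifiedAscent {n : ℕ} (x : Word n) (cayley : IsCayley x)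
  (ascentTop⇔leftmostCopy : ∀ i v → AscentTop x i v ⇔ LeftmostCopy x i v) where

  open Standardization x (IsCayley⇒positive cayley)

  leftmost⇒ascentTop : ∀ m → (∀ j → toℕ j < toℕ m → x j ≢ x m) →
                       toℕ m ≡ 0 ⊎ ∃[ k ] (toℕ m ≡ suc (toℕ k) × x k < x m)
  leftmost⇒ascentTop m leftmost =
    proj₂ (Equivalence.from (ascentTop⇔leftmostCopy m (x m))
      (IsCayley⇒positive cayley m , ≤-maxW x m , refl , λ j xj≡xm → ≮⇒≥ (λ j<m → leftmost j j<m xj≡xm)))

  first-minimum : ∀ z → toℕ z ≡ 0 → ∀ m → x z ≤ x m
  first-minimum z z≡0 m = go m (<-wellFounded m)
    where
    go : ∀ m → Acc _<ᶠ_ m → x z ≤ x m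
    go m (acc earlier) with any? (λ j → (toℕ j <? toℕ m) ×-dec (x j ≟ x m))
    ... | yes (j , j<m , xj≡xm) = subst (x z ≤_) xj≡xm (go j (earlier j<m))
    ... | no ∄j with leftmost⇒ascentTop m (λ j j<m xj≡xm → ∄j (j , j<m , xj≡xm))
    ... | inj₁ m≡0 = ≤-reflexive (cong x (toℕ-injective (trans z≡0 (sym m≡0))))
    ... | inj₂ (k , m≡1+k , xk<xm) =
      ≤-trans (go k (earlier (subst (toℕ k <_) (sym m≡1+k) (n<1+n (toℕ k))))) (<⇒≤ xk<xm)

  st-first : ∀ z → toℕ z ≡ 0 → st x z ≡ 1
  st-first z z≡0 = st-minimum z ¬≺z
    where
    ¬≺z : ∀ j → ¬ j ≺ z
    ¬≺z j (inj₁ xj<xz)       = <⇒≱ xj<xz (first-minimum z z≡0 j)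
    ¬≺z j (inj₂ (_ , j<z))   = n≮0 (subst (toℕ j <_) z≡0 j<z)

  st-avoids-pattern : ∀ (i k j : Fin n) → toℕ k ≡ suc (toℕ i) → toℕ k < toℕ j →
                      st x k < st x i → st x k ≡ st x j + 1 → ⊥
  st-avoids-pattern i k j k≡1+i k<j stk<sti stk≡stj+1 =
    [ k≢0 , ¬smaller-before-k ] (leftmost⇒ascentTop k k-leftmost)
    where
    stk≡1+stj : st x k ≡ suc (st x j)
    stk≡1+stj = trans stk≡stj+1 (+-comm (st x j) 1)
    j≺k : j ≺ k
    j≺k = st-reflects-< (subst (st x j <_) (sym stk≡1+stj) (n<1+n (st x j)))
    xj<xk : x j < x k
    xj<xk with j≺k
    ... | inj₁ xj<xk     = xj<xk
    ... | inj₂ (_ , j<k) = ⊥-elim (<-asym j<k k<j)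
    k-leftmost : ∀ m → toℕ m < toℕ k → x m ≢ x k
    k-leftmost m m<k xm≡xk =
      st-consecutive stk≡1+stj m (inj₁ (subst (x j <_) (sym xm≡xk) xj<xk)) (inj₂ (xm≡xk , m<k))
    k≢0 : toℕ k ≢ 0
    k≢0 k≡0 = 0≢1+n (trans (sym k≡0) k≡1+i)
    ¬smaller-before-k : ¬ (∃[ i′ ] (toℕ k ≡ suc (toℕ i′) × x i′ < x k))
    ¬smaller-before-k (i′ , k≡1+i′ , xi′<xk) with toℕ-injective (suc-injective (trans (sym k≡1+i′) k≡1+i))
    ... | refl = <-asym stk<sti (st-mono (inj₁ xi′<xk))

proposition3p4 : (n : ℕ) (x : Word n) → IsModAsc x → InΩ (st x)
proposition3p4 n x (cayley , ascentTop⇔leftmostCopy) = st-isPerm , st-first , st-avoids-pattern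
  where
  open ModifiedAscent x cayley ascentTop⇔leftmostCopy
  open Standardization x (IsCayley⇒positive cayley)
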